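{- Let $d$ be a degree sequence with a balanced partition $(a,b)\in\mathrm{BP}(d)$, where $a=(a_1,\dots,a_p)$ and $b=(b_1,\dots,b_q)$ are non-increasing, and let $t$ be a positive integer. Then $(a,b)$ is $t$-tot-bigraphic if and only if, for all $\ell=1,\dots,p$, $$\sum_{i=1}^{\ell} a_i \le \sum_{i=1}^{q}\min\{\ell,b_i\}+t.$$
   Context: A degree sequence is a non-increasing sequence of positive integers with even sum. $\mathrm{BP}(d)$ is the set of pairs $(a,b)$ of complementary subsequences of $d$ (together forming $d$) with equal sums. Multigraphs are loopless (parallel edges allowed). For a multigraph $H=(V,E)$, $\mathrm{TotMult}(H)=|E|-|E'|$ where $E'$ is the edge set of the underlying simple graph (one copy per adjacent pair). The partition $(a,b)$ is $t$-tot-bigraphic if there exists a loopless multigraph $H$ whose underlying graph is bipartite with sides $A,B$, such that the degree sequence of $A$ is $a$, that of $B$ is $b$, and $\mathrm{TotMult}(H)\le t$. -}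

module Defs where

open import Data.Nat using (ℕ; zero; suc; _+_; _∸_; _≤_; _≥_; _<_; _⊓_)
open import Data.Nat.Divisibility using (_∣_)
open import Data.Fin using (Fin; zero; suc)
open import Data.List using (List; length; lookup; take; map)
open import Data.Nat.ListAction using (sum)
open import Data.List.Relation.Unary.All using (All)
open import Data.List.Relation.Unary.Linked using (Linked)
open import Data.List.Relation.Ternary.Interleaving.Propositional using (Interleaving)
open import Data.Product using (Σ; _×_; ∃)
open import Relation.Binary.PropositionalEquality using (_≡_)

Σᶠ : (n : ℕ) → (Fin n → ℕ) → ℕ
Σᶠ zero    f = 0
Σᶠ (suc n) f = f zero + Σᶠ n (λ i → f (suc i))

NonIncreasing : List ℕ → Set
NonIncreasing = Linked _≥_

IsDegreeSequence : List ℕ → Set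
IsDegreeSequence d = NonIncreasing d × All (λ x → 1 ≤ x) d × (2 ∣ sum d)

IsBalancedPartition : List ℕ → List ℕ → List ℕ → Set
IsBalancedPartition d a b = Interleaving a b d × sum a ≡ sum b

-- A loopless bipartite multigraph with sides A = Fin p and B = Fin q is given by
-- the edge multiplicity  m i j  between vertex i ∈ A and vertex j ∈ B
-- (no edges inside a side, no loops).
BipMultigraph : ℕ → ℕ → Set
BipMultigraph p q = Fin p → Fin q → ℕ

-- TotMult = |E| - |E'| = Σ over pairs of (multiplicity - 1) for adjacent pairs
TotMult : ∀ {p q} → BipMultigraph p q → ℕ
TotMult {p} {q} m = Σᶠ p (λ i → Σᶠ q (λ j → m i j ∸ 1))

degA : ∀ {p q} → BipMultigraph p q → Fin p → ℕ
degA {p} {q} m i = Σᶠ q (λ j → m i j)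

degB : ∀ {p q} → BipMultigraph p q → Fin q → ℕ
degB {p} {q} m j = Σᶠ p (λ i → m i j)

TotBigraphic : ℕ → List ℕ → List ℕ → Set
TotBigraphic t a b =
  Σ (BipMultigraph (length a) (length b)) λ m →
    ((i : Fin (length a)) → degA m i ≡ lookup a i) ×
    ((j : Fin (length b)) → degB m j ≡ lookup b j) ×
    TotMult m ≤ t

GaleRyserT : ℕ → List ℕ → List ℕ → ℕ → Set
GaleRyserT t a b ℓ = sum (take ℓ a) ≤ sum (map (λ x → ℓ ⊓ x) b) + t

-- Necessity: split each entry of a column into its first edge and its parallel copies. Among
-- the first ℓ rows, column j has at most min(ℓ, b_j) first edges, and all the copies together are
-- counted by TotMult.
--
-- Sufficiency: start from the multigraph whose column j has one edge to each of the first
-- min(b_j, p) rows and its surplus b_j ∸ p as parallel edges to row 0. That surplus is forced,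
-- and the inequalities say precisely that the row degrees of this multigraph dominate a in prefix
-- sums, up to a slack of t minus the total surplus. Units are then moved inside columns until the
-- row degrees are a. First, while slack remains, a unit goes up into row 0 from the last nonempty
-- row, creating at most one parallel edge. Then, row by row from the top, each excess unit goes
-- down to the first row below whose degree is still short of its target. As a is non-increasing,
-- that row has a smaller degree than the sending row, so some column has a smaller entry there,
-- and moving the unit within that column creates no parallel edge.

module Submission where

open import Defs
open import Data.Nat using (ℕ; zero; suc; pred; _+_; _∸_; _⊓_; _≤_; _≥_; _<_; z≤n; s≤s; _≤?_; _<?_; >-nonZero)
open import Data.Nat.Properties hiding (_≟_)
open import Data.Fin as Fin using (Fin; zero; suc; _≟_)
open import Data.Fin.Properties using () renaming (suc-injective to Fin-suc-injective)
open import Data.Vec.Functional using (updateAt; tail) renaming (_∷_ to _◂_)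
open import Data.Vec.Functional.Properties using (updateAt-updates; updateAt-minimal)
open import Data.List using (List; []; _∷_; length; lookup; take; map)
open import Data.Nat.ListAction using (sum)
open import Data.List.Relation.Unary.Sorted.TotalOrder.Properties using (lookup-mono-≤)
open import Relation.Binary.Properties.TotalOrder ≤-totalOrder using (≥-totalOrder)
open import Relation.Binary.Core using (_Preserves_⟶_)
open import Algebra.Properties.CommutativeSemigroup +-commutativeSemigroup using (interchange; x∙yz≈y∙xz)
open import Data.Product using (Σ-syntax; ∃; _×_; _,_)
open import Data.Sum as Sum using (_⊎_; inj₁; inj₂)
open import Relation.Nullary using (yes; no)
open import Relation.Binary.PropositionalEquality
open import Function using (_∘_; id; _⇔_; mk⇔)

<-cancel-≥ : ∀ {x y u v} → y ≤ x → x + u < y + v → u < v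
<-cancel-≥ {x} {y} {u} {v} y≤x lt = +-cancelˡ-< x u v (<-≤-trans lt (+-monoˡ-≤ v y≤x))

≡-cancel-< : ∀ {x y u v} → x + u ≡ y + v → x < y → v < u
≡-cancel-< {x} {y} {u} {v} e x<y =
  +-cancelˡ-< x v u (<-≤-trans (+-monoˡ-< v x<y) (≤-reflexive (sym e)))

-- Finite sums and prefix sums

Σᶠ-cong : ∀ n {f g : Fin n → ℕ} → f ≗ g → Σᶠ n f ≡ Σᶠ n g
Σᶠ-cong zero    f≗g = refl
Σᶠ-cong (suc n) f≗g = cong₂ _+_ (f≗g zero) (Σᶠ-cong n (f≗g ∘ suc))

Σᶠ-mono : ∀ n {f g : Fin n → ℕ} → (∀ i → f i ≤ g i) → Σᶠ n f ≤ Σᶠ n g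
Σᶠ-mono zero    f≤g = z≤n
Σᶠ-mono (suc n) f≤g = +-mono-≤ (f≤g zero) (Σᶠ-mono n (f≤g ∘ suc))

Σᶠ-zero : ∀ n → Σᶠ n (λ _ → 0) ≡ 0
Σᶠ-zero zero    = refl
Σᶠ-zero (suc n) = Σᶠ-zero n

Σᶠ-+ : ∀ n (f g : Fin n → ℕ) → Σᶠ n (λ i → f i + g i) ≡ Σᶠ n f + Σᶠ n g
Σᶠ-+ zero    f g = refl
Σᶠ-+ (suc n) f g = trans (cong (f zero + g zero +_) (Σᶠ-+ n (f ∘ suc) (g ∘ suc)))
                         (interchange (f zero) (g zero) _ _)

Σᶠ-swap : ∀ p q (f : Fin p → Fin q → ℕ) →
          Σᶠ p (λ i → Σᶠ q (f i)) ≡ Σᶠ q (λ j → Σᶠ p (λ i → f i j))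
Σᶠ-swap zero    q f = sym (Σᶠ-zero q)
Σᶠ-swap (suc p) q f = trans (cong (Σᶠ q (f zero) +_) (Σᶠ-swap p q (f ∘ suc)))
                            (sym (Σᶠ-+ q (f zero) _))

Σᶠ≡0⇒≡0 : ∀ n (f : Fin n → ℕ) → Σᶠ n f ≡ 0 → ∀ i → f i ≡ 0
Σᶠ≡0⇒≡0 (suc n) f Σf≡0 zero    = m+n≡0⇒m≡0 (f zero) Σf≡0
Σᶠ≡0⇒≡0 (suc n) f Σf≡0 (suc i) = Σᶠ≡0⇒≡0 n (f ∘ suc) (m+n≡0⇒n≡0 (f zero) Σf≡0) i

Σᶠ<Σᶠ⇒∃< : ∀ n (f g : Fin n → ℕ) → Σᶠ n f < Σᶠ n g → ∃ λ i → f i < g i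
Σᶠ<Σᶠ⇒∃< zero    f g ()
Σᶠ<Σᶠ⇒∃< (suc n) f g Σf<Σg with f zero <? g zero
... | yes f₀<g₀ = zero , f₀<g₀
... | no  f₀≮g₀ with Σᶠ<Σᶠ⇒∃< n (f ∘ suc) (g ∘ suc) (<-cancel-≥ (≮⇒≥ f₀≮g₀) Σf<Σg)
...   | i , fᵢ<gᵢ = suc i , fᵢ<gᵢ

Σᶠ-mono-except : ∀ n {f g : Fin n → ℕ} i {c d} → (∀ k → k ≢ i → f k ≤ g k) →
                 c + f i ≤ d + g i → c + Σᶠ n f ≤ d + Σᶠ n g
Σᶠ-mono-except (suc n) {f} {g} zero {c} {d} away here = begin
  c + (f zero + Σᶠ n (f ∘ suc))  ≡⟨ +-assoc c _ _ ⟨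
  c + f zero + Σᶠ n (f ∘ suc)    ≤⟨ +-mono-≤ here (Σᶠ-mono n (λ k → away (suc k) λ ())) ⟩
  d + g zero + Σᶠ n (g ∘ suc)    ≡⟨ +-assoc d _ _ ⟩
  d + (g zero + Σᶠ n (g ∘ suc))  ∎
  where open ≤-Reasoning
Σᶠ-mono-except (suc n) {f} {g} (suc i) {c} {d} away here = begin
  c + (f zero + Σᶠ n (f ∘ suc))  ≡⟨ x∙yz≈y∙xz c (f zero) _ ⟩
  f zero + (c + Σᶠ n (f ∘ suc))  ≤⟨ +-mono-≤ (away zero λ ()) (Σᶠ-mono-except n i away′ here) ⟩
  g zero + (d + Σᶠ n (g ∘ suc))  ≡⟨ x∙yz≈y∙xz (g zero) d _ ⟩
  d + (g zero + Σᶠ n (g ∘ suc))  ∎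
  where
    open ≤-Reasoning
    away′ : ∀ k → k ≢ i → f (suc k) ≤ g (suc k)
    away′ k k≢i = away (suc k) (k≢i ∘ Fin-suc-injective)

Σᶠ-cong-except : ∀ n {f g : Fin n → ℕ} i {c d} → (∀ k → k ≢ i → f k ≡ g k) →
                 c + f i ≡ d + g i → c + Σᶠ n f ≡ d + Σᶠ n g
Σᶠ-cong-except n i away here = ≤-antisym
  (Σᶠ-mono-except n i (λ k k≢i → ≤-reflexive (away k k≢i)) (≤-reflexive here))
  (Σᶠ-mono-except n i (λ k k≢i → ≤-reflexive (sym (away k k≢i))) (≤-reflexive (sym here)))

prefixSum : ∀ n → (Fin n → ℕ) → ℕ → ℕ
prefixSum n       f zero    = 0
prefixSum zero    f (suc ℓ) = 0
prefixSum (suc n) f (suc ℓ) = f zero + prefixSum n (tail f) ℓ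

prefixSum-cong : ∀ n {f g : Fin n → ℕ} ℓ → f ≗ g → prefixSum n f ℓ ≡ prefixSum n g ℓ
prefixSum-cong n       zero    f≗g = refl
prefixSum-cong zero    (suc ℓ) f≗g = refl
prefixSum-cong (suc n) (suc ℓ) f≗g = cong₂ _+_ (f≗g zero) (prefixSum-cong n ℓ (f≗g ∘ suc))

prefixSum-mono : ∀ n {f g : Fin n → ℕ} ℓ → (∀ i → f i ≤ g i) → prefixSum n f ℓ ≤ prefixSum n g ℓ
prefixSum-mono n       zero    f≤g = z≤n
prefixSum-mono zero    (suc ℓ) f≤g = z≤n
prefixSum-mono (suc n) (suc ℓ) f≤g = +-mono-≤ (f≤g zero) (prefixSum-mono n ℓ (f≤g ∘ suc))

prefixSum-+ : ∀ n (f g : Fin n → ℕ) ℓ →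
              prefixSum n (λ i → f i + g i) ℓ ≡ prefixSum n f ℓ + prefixSum n g ℓ
prefixSum-+ n       f g zero    = refl
prefixSum-+ zero    f g (suc ℓ) = refl
prefixSum-+ (suc n) f g (suc ℓ) =
  trans (cong (f zero + g zero +_) (prefixSum-+ n (f ∘ suc) (g ∘ suc) ℓ))
        (interchange (f zero) (g zero) _ _)

prefixSum-swap : ∀ n q (f : Fin n → Fin q → ℕ) ℓ →
                 prefixSum n (λ i → Σᶠ q (f i)) ℓ ≡ Σᶠ q (λ j → prefixSum n (λ i → f i j) ℓ)
prefixSum-swap n       q f zero    = sym (Σᶠ-zero q)
prefixSum-swap zero    q f (suc ℓ) = sym (Σᶠ-zero q)
prefixSum-swap (suc n) q f (suc ℓ) =
  trans (cong (Σᶠ q (f zero) +_) (prefixSum-swap n q (f ∘ suc) ℓ)) (sym (Σᶠ-+ q (f zero) _))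

prefixSum≤Σᶠ : ∀ n (f : Fin n → ℕ) ℓ → prefixSum n f ℓ ≤ Σᶠ n f
prefixSum≤Σᶠ n       f zero    = z≤n
prefixSum≤Σᶠ zero    f (suc ℓ) = z≤n
prefixSum≤Σᶠ (suc n) f (suc ℓ) = +-monoʳ-≤ (f zero) (prefixSum≤Σᶠ n (f ∘ suc) ℓ)

prefixSum-all : ∀ n (f : Fin n → ℕ) ℓ → n ≤ ℓ → prefixSum n f ℓ ≡ Σᶠ n f
prefixSum-all zero    f zero    _         = refl
prefixSum-all zero    f (suc ℓ) _         = refl
prefixSum-all (suc n) f (suc ℓ) (s≤s n≤ℓ) = cong (f zero +_) (prefixSum-all n (f ∘ suc) ℓ n≤ℓ)

prefixSum≤length : ∀ n (f : Fin n → ℕ) ℓ → (∀ i → f i ≤ 1) → prefixSum n f ℓ ≤ ℓ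
prefixSum≤length n       f zero    f≤1 = z≤n
prefixSum≤length zero    f (suc ℓ) f≤1 = z≤n
prefixSum≤length (suc n) f (suc ℓ) f≤1 = +-mono-≤ (f≤1 zero) (prefixSum≤length n (f ∘ suc) ℓ (f≤1 ∘ suc))

Σᶠ≡0⇒prefixSum≡Σᶠ : ∀ n (f : Fin n → ℕ) ℓ → Σᶠ n f ≡ 0 → prefixSum n f ℓ ≡ Σᶠ n f
Σᶠ≡0⇒prefixSum≡Σᶠ n f ℓ Σf≡0 =
  trans (n≤0⇒n≡0 (≤-trans (prefixSum≤Σᶠ n f ℓ) (≤-reflexive Σf≡0))) (sym Σf≡0)

prefixSum≤saturated : ∀ n (a r : Fin n → ℕ) ℓ → Σᶠ n a ≡ Σᶠ n r → prefixSum n r ℓ ≡ Σᶠ n r →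
                      prefixSum n a ℓ ≤ prefixSum n r ℓ
prefixSum≤saturated n a r ℓ total saturated =
  ≤-trans (prefixSum≤Σᶠ n a ℓ) (≤-reflexive (trans total (sym saturated)))

infix 4 _≼_ _≼⟨_⟩_

_≼_ : ∀ {n} → (Fin n → ℕ) → (Fin n → ℕ) → Set
_≼_ {n} a r = ∀ ℓ → prefixSum n a ℓ ≤ prefixSum n r ℓ

_≼⟨_⟩_ : ∀ {n} → (Fin n → ℕ) → ℕ → (Fin n → ℕ) → Set
_≼⟨_⟩_ {n} a s r = ∀ ℓ → prefixSum n a ℓ ≤ prefixSum n r ℓ + s

≼-tail : ∀ {n} (a r : Fin (suc n) → ℕ) → r zero ≡ a zero → a ≼ r → tail a ≼ tail r
≼-tail a r r₀≡a₀ a≼r ℓ =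
  +-cancelˡ-≤ (a zero) _ _ (subst (λ x → _ ≤ x + _) r₀≡a₀ (a≼r (suc ℓ)))

Σᶠ-tail : ∀ n (a r : Fin (suc n) → ℕ) → r zero ≡ a zero → Σᶠ (suc n) a ≡ Σᶠ (suc n) r →
          Σᶠ n (tail a) ≡ Σᶠ n (tail r)
Σᶠ-tail n a r r₀≡a₀ total = +-cancelˡ-≡ (a zero) _ _ (trans total (cong (_+ Σᶠ n (tail r)) r₀≡a₀))

excess : ∀ {q} → (Fin q → ℕ) → ℕ
excess {q} R = Σᶠ q (λ j → R j ∸ 1)

Σᶠ-degA≡Σᶠ-degB : ∀ {p q} (m : BipMultigraph p q) → Σᶠ p (degA m) ≡ Σᶠ q (degB m)
Σᶠ-degA≡Σᶠ-degB {p} {q} m = Σᶠ-swap p q m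

Σᶠ-degA-cong : ∀ {p q} (m′ m : BipMultigraph p q) → degB m′ ≗ degB m → Σᶠ p (degA m′) ≡ Σᶠ p (degA m)
Σᶠ-degA-cong {q = q} m′ m columns = begin
  Σᶠ _ (degA m′)  ≡⟨ Σᶠ-degA≡Σᶠ-degB m′ ⟩
  Σᶠ q (degB m′)  ≡⟨ Σᶠ-cong q columns ⟩
  Σᶠ q (degB m)   ≡⟨ Σᶠ-degA≡Σᶠ-degB m ⟨
  Σᶠ _ (degA m)   ∎
  where open ≡-Reasoning

-- Necessity

x≡1⊓x+x∸1 : ∀ x → x ≡ 1 ⊓ x + (x ∸ 1)
x≡1⊓x+x∸1 zero    = refl
x≡1⊓x+x∸1 (suc x) = refl

prefixSum-column-bound : ∀ n (g : Fin n → ℕ) ℓ →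
                         prefixSum n g ℓ ≤ ℓ ⊓ Σᶠ n g + prefixSum n (λ i → g i ∸ 1) ℓ
prefixSum-column-bound n g ℓ = begin
  prefixSum n g ℓ
    ≡⟨ prefixSum-cong n ℓ (x≡1⊓x+x∸1 ∘ g) ⟩
  prefixSum n (λ i → 1 ⊓ g i + (g i ∸ 1)) ℓ
    ≡⟨ prefixSum-+ n _ _ ℓ ⟩
  prefixSum n (λ i → 1 ⊓ g i) ℓ + prefixSum n (λ i → g i ∸ 1) ℓ
    ≤⟨ +-monoˡ-≤ _ (⊓-glb (prefixSum≤length n _ ℓ (λ i → m⊓n≤m 1 (g i)))
                          (≤-trans (prefixSum-mono n ℓ (λ i → m⊓n≤n 1 (g i))) (prefixSum≤Σᶠ n g ℓ))) ⟩
  ℓ ⊓ Σᶠ n g + prefixSum n (λ i → g i ∸ 1) ℓ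
    ∎
  where open ≤-Reasoning

prefixSum-degA-bound : ∀ {p q} (m : BipMultigraph p q) ℓ →
                       prefixSum p (degA m) ℓ ≤ Σᶠ q (λ j → ℓ ⊓ degB m j) + TotMult m
prefixSum-degA-bound {p} {q} m ℓ = begin
  prefixSum p (degA m) ℓ
    ≡⟨ prefixSum-swap p q m ℓ ⟩
  Σᶠ q (λ j → prefixSum p (λ i → m i j) ℓ)
    ≤⟨ Σᶠ-mono q (λ j → prefixSum-column-bound p (λ i → m i j) ℓ) ⟩
  Σᶠ q (λ j → ℓ ⊓ degB m j + prefixSum p (λ i → m i j ∸ 1) ℓ)
    ≡⟨ Σᶠ-+ q _ _ ⟩
  Σᶠ q (λ j → ℓ ⊓ degB m j) + Σᶠ q (λ j → prefixSum p (λ i → m i j ∸ 1) ℓ)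
    ≤⟨ +-monoʳ-≤ _ (Σᶠ-mono q (λ j → prefixSum≤Σᶠ p (λ i → m i j ∸ 1) ℓ)) ⟩
  Σᶠ q (λ j → ℓ ⊓ degB m j) + Σᶠ q (λ j → Σᶠ p (λ i → m i j ∸ 1))
    ≡⟨ cong (Σᶠ q (λ j → ℓ ⊓ degB m j) +_) (Σᶠ-swap p q (λ i j → m i j ∸ 1)) ⟨
  Σᶠ q (λ j → ℓ ⊓ degB m j) + TotMult m
    ∎
  where open ≤-Reasoning

necessary : ∀ {p q} (m : BipMultigraph p q) (a : Fin p → ℕ) (b : Fin q → ℕ) t →
            degA m ≗ a → degB m ≗ b → TotMult m ≤ t →
            ∀ ℓ → prefixSum p a ℓ ≤ Σᶠ q (λ j → ℓ ⊓ b j) + t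
necessary {p} {q} m a b t degA≗a degB≗b cost ℓ = begin
  prefixSum p a ℓ                          ≡⟨ prefixSum-cong p ℓ degA≗a ⟨
  prefixSum p (degA m) ℓ                   ≤⟨ prefixSum-degA-bound m ℓ ⟩
  Σᶠ q (λ j → ℓ ⊓ degB m j) + TotMult m    ≡⟨ cong (_+ TotMult m) (Σᶠ-cong q (cong (ℓ ⊓_) ∘ degB≗b)) ⟩
  Σᶠ q (λ j → ℓ ⊓ b j) + TotMult m         ≤⟨ +-monoʳ-≤ _ cost ⟩
  Σᶠ q (λ j → ℓ ⊓ b j) + t                 ∎
  where open ≤-Reasoning

-- Moving units inside a column

record UnitMove {q} (c : ℕ) (X Y : Fin q → ℕ) : Set where
  field
    X′ Y′   : Fin q → ℕ
    columns : ∀ j → X′ j + Y′ j ≡ X j + Y j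
    source  : Σᶠ q X ≡ suc (Σᶠ q X′)
    target  : Σᶠ q Y′ ≡ suc (Σᶠ q Y)
    cost    : excess X′ + excess Y′ ≤ c + (excess X + excess Y)

moveAt : ∀ {q} c (X Y : Fin q → ℕ) j → 0 < X j →
         (pred (X j) ∸ 1) + (suc (Y j) ∸ 1) ≤ c + ((X j ∸ 1) + (Y j ∸ 1)) → UnitMove c X Y
moveAt {q} c X Y j 0<Xj local = record
  { X′ = X′ ; Y′ = Y′ ; columns = columns ; source = source ; target = target ; cost = cost }
  where
    X′ Y′ : Fin q → ℕ
    X′ = updateAt X j pred
    Y′ = updateAt Y j suc

    X′-away : ∀ k → k ≢ j → X′ k ≡ X k
    X′-away k k≢j = updateAt-minimal k j X k≢j

    Y′-away : ∀ k → k ≢ j → Y′ k ≡ Y k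
    Y′-away k k≢j = updateAt-minimal k j Y k≢j

    suc-pred-Xj : suc (pred (X j)) ≡ X j
    suc-pred-Xj = suc-pred (X j) {{>-nonZero 0<Xj}}

    columns : ∀ k → X′ k + Y′ k ≡ X k + Y k
    columns k with k ≟ j
    ... | yes refl = begin
      X′ k + Y′ k            ≡⟨ cong₂ _+_ (updateAt-updates k X) (updateAt-updates k Y) ⟩
      pred (X k) + suc (Y k) ≡⟨ +-suc _ _ ⟩
      suc (pred (X k)) + Y k ≡⟨ cong (_+ Y k) suc-pred-Xj ⟩
      X k + Y k              ∎
      where open ≡-Reasoning
    ... | no k≢j = cong₂ _+_ (X′-away k k≢j) (Y′-away k k≢j)

    source : Σᶠ q X ≡ suc (Σᶠ q X′)
    source = Σᶠ-cong-except q j (λ k k≢j → sym (X′-away k k≢j))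
                                (trans (sym suc-pred-Xj) (cong suc (sym (updateAt-updates j X))))

    target : Σᶠ q Y′ ≡ suc (Σᶠ q Y)
    target = Σᶠ-cong-except q j Y′-away (updateAt-updates j Y)

    cost : excess X′ + excess Y′ ≤ c + (excess X + excess Y)
    cost = begin
      excess X′ + excess Y′                       ≡⟨ Σᶠ-+ q _ _ ⟨
      Σᶠ q (λ k → (X′ k ∸ 1) + (Y′ k ∸ 1))        ≤⟨ Σᶠ-mono-except q j away here ⟩
      c + Σᶠ q (λ k → (X k ∸ 1) + (Y k ∸ 1))      ≡⟨ cong (c +_) (Σᶠ-+ q _ _) ⟩
      c + (excess X + excess Y)                   ∎
      where
        open ≤-Reasoning
        away : ∀ k → k ≢ j → (X′ k ∸ 1) + (Y′ k ∸ 1) ≤ (X k ∸ 1) + (Y k ∸ 1)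
        away k k≢j = ≤-reflexive (cong₂ (λ x y → (x ∸ 1) + (y ∸ 1)) (X′-away k k≢j) (Y′-away k k≢j))
        here : (X′ j ∸ 1) + (Y′ j ∸ 1) ≤ c + ((X j ∸ 1) + (Y j ∸ 1))
        here = ≤-trans (≤-reflexive (cong₂ (λ x y → (x ∸ 1) + (y ∸ 1))
                                           (updateAt-updates j X) (updateAt-updates j Y)))
                       local

-- Moving a unit of a column from an entry x to a smaller entry y creates no parallel edge;
-- moving it anywhere creates at most one.
downhill-cost : ∀ {x y} → y < x → (pred x ∸ 1) + (suc y ∸ 1) ≤ (x ∸ 1) + (y ∸ 1)
downhill-cost {suc x}       {zero}  _        = +-monoˡ-≤ 0 (m∸n≤m x 1)
downhill-cost {suc (suc x)} {suc y} _        = ≤-reflexive (+-suc x y)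
downhill-cost {suc zero}    {suc y} (s≤s ())

move-cost : ∀ x y → (pred x ∸ 1) + (suc y ∸ 1) ≤ 1 + ((x ∸ 1) + (y ∸ 1))
move-cost x y = begin
  (pred x ∸ 1) + y         ≤⟨ +-mono-≤ (∸-monoˡ-≤ 1 (pred[n]≤n {x})) (m≤n+m∸n y 1) ⟩
  (x ∸ 1) + (1 + (y ∸ 1))  ≡⟨ x∙yz≈y∙xz (x ∸ 1) 1 (y ∸ 1) ⟩
  1 + ((x ∸ 1) + (y ∸ 1))  ∎
  where open ≤-Reasoning

move-downhill : ∀ {q} (X Y : Fin q → ℕ) → Σᶠ q Y < Σᶠ q X → UnitMove 0 X Y
move-downhill {q} X Y ΣY<ΣX with Σᶠ<Σᶠ⇒∃< q Y X ΣY<ΣX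
... | j , Yj<Xj = moveAt 0 X Y j (≤-<-trans z≤n Yj<Xj) (downhill-cost Yj<Xj)

move-any : ∀ {q} (X Y : Fin q → ℕ) → 0 < Σᶠ q X → UnitMove 1 X Y
move-any {q} X Y 0<ΣX with Σᶠ<Σᶠ⇒∃< q (λ _ → 0) X (subst (_< Σᶠ q X) (sym (Σᶠ-zero q)) 0<ΣX)
... | j , 0<Xj = moveAt 1 X Y j 0<Xj (move-cost (X j) (Y j))

degB-extend : ∀ {N q} (X′ Y′ X Y : Fin q → ℕ) (M : BipMultigraph N q) →
              (∀ j → X′ j + Y′ j ≡ X j + Y j) → degB (X′ ◂ Y′ ◂ M) ≗ degB (X ◂ Y ◂ M)
degB-extend X′ Y′ X Y M same j = begin
  X′ j + (Y′ j + degB M j)  ≡⟨ +-assoc (X′ j) (Y′ j) _ ⟨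
  X′ j + Y′ j + degB M j    ≡⟨ cong (_+ degB M j) (same j) ⟩
  X j + Y j + degB M j      ≡⟨ +-assoc (X j) (Y j) _ ⟩
  X j + (Y j + degB M j)    ∎
  where open ≡-Reasoning

TotMult-extend : ∀ {N q} (X′ Y′ X Y : Fin q → ℕ) (M : BipMultigraph N q) k →
                 excess X′ + excess Y′ ≤ k + (excess X + excess Y) →
                 TotMult (X′ ◂ Y′ ◂ M) ≤ k + TotMult (X ◂ Y ◂ M)
TotMult-extend X′ Y′ X Y M k le = begin
  excess X′ + (excess Y′ + TotMult M)      ≡⟨ +-assoc (excess X′) (excess Y′) _ ⟨
  excess X′ + excess Y′ + TotMult M        ≤⟨ +-monoˡ-≤ (TotMult M) le ⟩
  k + (excess X + excess Y) + TotMult M    ≡⟨ +-assoc k _ _ ⟩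
  k + (excess X + excess Y + TotMult M)    ≡⟨ cong (k +_) (+-assoc (excess X) (excess Y) _) ⟩
  k + (excess X + (excess Y + TotMult M))  ∎
  where open ≤-Reasoning

degB-insert : ∀ {N q} (R′ R S : Fin q → ℕ) (M′ M : BipMultigraph N q) →
              degB (R′ ◂ M′) ≗ degB (R ◂ M) → degB (R′ ◂ S ◂ M′) ≗ degB (R ◂ S ◂ M)
degB-insert R′ R S M′ M same j = begin
  R′ j + (S j + degB M′ j)  ≡⟨ x∙yz≈y∙xz (R′ j) (S j) _ ⟩
  S j + (R′ j + degB M′ j)  ≡⟨ cong (S j +_) (same j) ⟩
  S j + (R j + degB M j)    ≡⟨ x∙yz≈y∙xz (S j) (R j) _ ⟩
  R j + (S j + degB M j)    ∎
  where open ≡-Reasoning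

TotMult-insert : ∀ {N q} (R′ R S : Fin q → ℕ) (M′ M : BipMultigraph N q) k →
                 TotMult (R′ ◂ M′) ≤ k + TotMult (R ◂ M) →
                 TotMult (R′ ◂ S ◂ M′) ≤ k + TotMult (R ◂ S ◂ M)
TotMult-insert R′ R S M′ M k le = begin
  excess R′ + (excess S + TotMult M′)      ≡⟨ x∙yz≈y∙xz (excess R′) (excess S) _ ⟩
  excess S + (excess R′ + TotMult M′)      ≤⟨ +-monoʳ-≤ (excess S) le ⟩
  excess S + (k + (excess R + TotMult M))  ≡⟨ x∙yz≈y∙xz (excess S) k _ ⟩
  k + (excess S + (excess R + TotMult M))  ≡⟨ cong (k +_) (x∙yz≈y∙xz (excess S) (excess R) _) ⟩
  k + (excess R + (excess S + TotMult M))  ∎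
  where open ≤-Reasoning

-- One unit goes from R to the first row of M whose degree is short of its target in a; the rows
-- above it already meet a.
record Pushed {N q} (R : Fin q → ℕ) (M : BipMultigraph N q) (a : Fin N → ℕ) : Set where
  field
    R′      : Fin q → ℕ
    M′      : BipMultigraph N q
    columns : degB (R′ ◂ M′) ≗ degB (R ◂ M)
    top     : Σᶠ q R ≡ suc (Σᶠ q R′)
    cost    : TotMult (R′ ◂ M′) ≤ TotMult (R ◂ M)
    prefix  : ∀ ℓ → prefixSum N a ℓ ≤ prefixSum N (degA M′) ℓ
                  ⊎ prefixSum N (degA M′) ℓ ≡ suc (prefixSum N (degA M) ℓ)

push : ∀ {N q} (R : Fin q → ℕ) (M : BipMultigraph N q) (a : Fin N → ℕ) →
       (∀ i → a i < Σᶠ q R) → Σᶠ N (degA M) < Σᶠ N a → Pushed R M a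
push {zero}      R M a a<R ()
push {suc N} {q} R M a a<R deficit with degA M zero <? a zero
... | yes M₀<a₀ = record
  { R′      = X′
  ; M′      = Y′ ◂ tail M
  ; columns = degB-extend X′ Y′ R (M zero) (tail M) columns
  ; top     = source
  ; cost    = TotMult-extend X′ Y′ R (M zero) (tail M) 0 cost
  ; prefix  = λ { zero → inj₁ z≤n
                ; (suc ℓ) → inj₂ (cong (_+ prefixSum N (degA (tail M)) ℓ) target) }
  }
  where open UnitMove (move-downhill R (M zero) (<-trans M₀<a₀ (a<R zero)))
... | no M₀≮a₀ = record
  { R′      = R′
  ; M′      = M zero ◂ M′
  ; columns = degB-insert R′ R (M zero) M′ (tail M) columns
  ; top     = top
  ; cost    = TotMult-insert R′ R (M zero) M′ (tail M) 0 cost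
  ; prefix  = prefix′
  }
  where
    a₀≤M₀ = ≮⇒≥ M₀≮a₀
    open Pushed (push R (tail M) (tail a) (a<R ∘ suc) (<-cancel-≥ a₀≤M₀ deficit))
    prefix′ : ∀ ℓ → prefixSum (suc N) a ℓ ≤ prefixSum (suc N) (degA (M zero ◂ M′)) ℓ
                  ⊎ prefixSum (suc N) (degA (M zero ◂ M′)) ℓ ≡ suc (prefixSum (suc N) (degA M) ℓ)
    prefix′ zero = inj₁ z≤n
    prefix′ (suc ℓ) with prefix ℓ
    ... | inj₁ dominated = inj₁ (+-mono-≤ a₀≤M₀ dominated)
    ... | inj₂ raised    = inj₂ (trans (cong (degA M zero +_) raised) (+-suc _ _))

-- One unit goes to R from the last nonempty row of M, so each prefix of M′ either misses the
-- change or is all of M′.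
record Pulled {N q} (R : Fin q → ℕ) (M : BipMultigraph N q) : Set where
  field
    R′      : Fin q → ℕ
    M′      : BipMultigraph N q
    columns : degB (R′ ◂ M′) ≗ degB (R ◂ M)
    top     : Σᶠ q R′ ≡ suc (Σᶠ q R)
    cost    : TotMult (R′ ◂ M′) ≤ 1 + TotMult (R ◂ M)
    prefix  : ∀ ℓ → prefixSum N (degA M′) ℓ ≡ prefixSum N (degA M) ℓ
                  ⊎ prefixSum N (degA M′) ℓ ≡ Σᶠ N (degA M′)

pull : ∀ {N q} (R : Fin q → ℕ) (M : BipMultigraph N q) → 0 < Σᶠ N (degA M) → Pulled R M
pull {zero}      R M ()
pull {suc N} {q} R M 0<ΣM with 0 <? Σᶠ N (degA (tail M))
... | yes 0<Σtail = record
  { R′      = R′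
  ; M′      = M zero ◂ M′
  ; columns = degB-insert R′ R (M zero) M′ (tail M) columns
  ; top     = top
  ; cost    = TotMult-insert R′ R (M zero) M′ (tail M) 1 cost
  ; prefix  = λ { zero → inj₁ refl
                ; (suc ℓ) → Sum.map (cong (degA M zero +_)) (cong (degA M zero +_)) (prefix ℓ) }
  }
  where open Pulled (pull R (tail M) 0<Σtail)
... | no 0≮Σtail = record
  { R′      = Y′
  ; M′      = X′ ◂ tail M
  ; columns = degB-extend Y′ X′ R (M zero) (tail M)
                (λ j → trans (+-comm (Y′ j) (X′ j)) (trans (columns j) (+-comm (M zero j) (R j))))
  ; top     = target
  ; cost    = TotMult-extend Y′ X′ R (M zero) (tail M) 1
                (subst₂ (λ u v → u ≤ 1 + v) (+-comm (excess X′) _) (+-comm (excess (M zero)) _) cost)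
  ; prefix  = λ { zero → inj₁ refl
                ; (suc ℓ) → inj₂ (cong (Σᶠ q X′ +_) (Σᶠ≡0⇒prefixSum≡Σᶠ N _ ℓ Σtail≡0)) }
  }
  where
    Σtail≡0 : Σᶠ N (degA (tail M)) ≡ 0
    Σtail≡0 = n≤0⇒n≡0 (≮⇒≥ 0≮Σtail)
    0<M₀ : 0 < degA M zero
    0<M₀ = subst (0 <_) (trans (cong (degA M zero +_) Σtail≡0) (+-identityʳ _)) 0<ΣM
    open UnitMove (move-any (M zero) R 0<M₀)

-- Rearranging a multigraph with fixed column degrees

record Rearrangement {p q} (c : ℕ) (m : BipMultigraph p q) (P : BipMultigraph p q → Set) : Set where
  field
    matrix    : BipMultigraph p q
    columns   : degB matrix ≗ degB m
    cost      : TotMult matrix ≤ TotMult m + c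
    satisfies : P matrix

unchanged : ∀ {p q c} {P : BipMultigraph p q → Set} {m} → P m → Rearrangement c m P
unchanged {c = c} {m = m} Pm = record
  { matrix = m ; columns = λ _ → refl ; cost = m≤m+n (TotMult m) c ; satisfies = Pm }

weaken : ∀ {p q c} {P Q : BipMultigraph p q → Set} {m} → (∀ {m′} → P m′ → Q m′) →
         Rearrangement c m P → Rearrangement c m Q
weaken P⇒Q r = record
  { matrix = matrix r ; columns = columns r ; cost = cost r ; satisfies = P⇒Q (satisfies r) }
  where open Rearrangement

infixl 1 _⨾_

_⨾_ : ∀ {p q c d} {P Q : BipMultigraph p q → Set} {m} → Rearrangement c m P →
      (∀ {m′} → Σᶠ p (degA m′) ≡ Σᶠ p (degA m) → P m′ → Rearrangement d m′ Q) → Rearrangement (c + d) m Q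
_⨾_ {c = c} {d} {m = m} r next = record
  { matrix    = matrix r′
  ; columns   = λ j → trans (columns r′ j) (columns r j)
  ; cost      = begin
      TotMult (matrix r′)    ≤⟨ cost r′ ⟩
      TotMult (matrix r) + d ≤⟨ +-monoˡ-≤ d (cost r) ⟩
      TotMult m + c + d      ≡⟨ +-assoc _ c d ⟩
      TotMult m + (c + d)    ∎
  ; satisfies = satisfies r′
  }
  where
    open ≤-Reasoning
    open Rearrangement
    r′ = next (Σᶠ-degA-cong (matrix r) m (columns r)) (satisfies r)

keep-top : ∀ {N q c} {P : BipMultigraph N q → Set} (m : BipMultigraph (suc N) q) →
           Rearrangement c (tail m) P →
           Rearrangement c m (λ m′ → degA m′ zero ≡ degA m zero × P (tail m′))
keep-top {c = c} m r = record
  { matrix    = m zero ◂ matrix r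
  ; columns   = λ j → cong (m zero j +_) (columns r j)
  ; cost      = ≤-trans (+-monoʳ-≤ (excess (m zero)) (cost r))
                        (≤-reflexive (sym (+-assoc (excess (m zero)) (TotMult (tail m)) c)))
  ; satisfies = refl , satisfies r
  }
  where open Rearrangement

lower-once : ∀ {N q} k (m : BipMultigraph (suc N) q) (a : Fin (suc N) → ℕ) →
             (∀ i → a (suc i) ≤ a zero) → degA m zero ≡ suc k + a zero →
             a ≼ degA m → Σᶠ (suc N) a ≡ Σᶠ (suc N) (degA m) →
             Rearrangement 0 m (λ m′ → degA m′ zero ≡ k + a zero × a ≼ degA m′)
lower-once {N} {q} k m a a≤a₀ top₀ dom total = record
  { matrix    = R′ ◂ M′
  ; columns   = columns
  ; cost      = ≤-trans cost (m≤m+n _ 0)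
  ; satisfies = top′ , dom′
  }
  where
    a₀<R : a zero < degA m zero
    a₀<R = subst (a zero <_) (sym top₀) (s≤s (m≤n+m (a zero) k))
    open Pushed (push (m zero) (tail m) (tail a) (λ i → ≤-<-trans (a≤a₀ i) a₀<R)
                      (≡-cancel-< total a₀<R))
    top′ : Σᶠ q R′ ≡ k + a zero
    top′ = suc-injective (trans (sym top) top₀)
    dom′ : a ≼ degA (R′ ◂ M′)
    dom′ zero = z≤n
    dom′ (suc ℓ) with prefix ℓ
    ... | inj₁ dominated = +-mono-≤ (subst (a zero ≤_) (sym top′) (m≤n+m (a zero) k)) dominated
    ... | inj₂ raised    = ≤-trans (dom (suc ℓ)) (≤-reflexive (begin
      degA m zero + prefixSum N (degA (tail m)) ℓ      ≡⟨ cong (_+ prefixSum N (degA (tail m)) ℓ) top ⟩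
      suc (Σᶠ q R′) + prefixSum N (degA (tail m)) ℓ    ≡⟨ +-suc _ _ ⟨
      Σᶠ q R′ + suc (prefixSum N (degA (tail m)) ℓ)    ≡⟨ cong (Σᶠ q R′ +_) raised ⟨
      Σᶠ q R′ + prefixSum N (degA M′) ℓ                ∎))
      where open ≡-Reasoning

lower-top : ∀ {N q} k (m : BipMultigraph (suc N) q) (a : Fin (suc N) → ℕ) →
            (∀ i → a (suc i) ≤ a zero) → degA m zero ≡ k + a zero →
            a ≼ degA m → Σᶠ (suc N) a ≡ Σᶠ (suc N) (degA m) →
            Rearrangement 0 m (λ m′ → degA m′ zero ≡ a zero × a ≼ degA m′)
lower-top zero    m a _    top dom _     = unchanged (top , dom)
lower-top (suc k) m a a≤a₀ top dom total =
  lower-once k m a a≤a₀ top dom total ⨾ λ same-total (top′ , dom′) →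
  lower-top k _ a a≤a₀ top′ dom′ (trans total (sym same-total))

rebalance : ∀ {N q} (m : BipMultigraph N q) (a : Fin N → ℕ) → a Preserves Fin._≤_ ⟶ _≥_ →
            a ≼ degA m → Σᶠ N a ≡ Σᶠ N (degA m) → Rearrangement 0 m (λ m′ → degA m′ ≗ a)
rebalance {zero}  m a _  _   _     = unchanged (λ ())
rebalance {suc N} m a a↘ dom total =
  lower-top (degA m zero ∸ a zero) m a (λ _ → a↘ z≤n) (sym (m∸n+n≡m a₀≤R₀)) dom total
    ⨾ λ {m′} same-total (top , dom′) →
  weaken (λ {m″} → glue m″ m′ top)
    (keep-top m′ (rebalance (tail m′) (tail a) (λ i≤j → a↘ (s≤s i≤j))
                   (≼-tail a (degA m′) top dom′)
                   (Σᶠ-tail N a (degA m′) top (trans total (sym same-total)))))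
  where
    a₀≤R₀ : a zero ≤ degA m zero
    a₀≤R₀ = subst₂ _≤_ (+-identityʳ _) (+-identityʳ _) (dom 1)
    glue : ∀ {q} (m″ m′ : BipMultigraph (suc N) q) → degA m′ zero ≡ a zero →
           degA m″ zero ≡ degA m′ zero × degA (tail m″) ≗ tail a → degA m″ ≗ a
    glue m″ m′ top (top′ , tail≗) zero    = trans top′ top
    glue m″ m′ top (top′ , tail≗) (suc i) = tail≗ i

raise-once : ∀ {N q} s (m : BipMultigraph (suc N) q) (a : Fin (suc N) → ℕ) →
             a ≼⟨ suc s ⟩ degA m → Σᶠ (suc N) a ≡ Σᶠ (suc N) (degA m) → 0 < Σᶠ N (degA (tail m)) →
             Rearrangement 1 m (λ m′ → a ≼⟨ s ⟩ degA m′)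
raise-once {N} {q} s m a dom total 0<Σtail = record
  { matrix    = R′ ◂ M′
  ; columns   = columns
  ; cost      = subst (TotMult (R′ ◂ M′) ≤_) (+-comm 1 (TotMult m)) cost
  ; satisfies = dom′
  }
  where
    open Pulled (pull (m zero) (tail m) 0<Σtail)
    dom′ : a ≼⟨ s ⟩ degA (R′ ◂ M′)
    dom′ zero = z≤n
    dom′ (suc ℓ) with prefix ℓ
    ... | inj₁ unchanged-prefix = ≤-trans (dom (suc ℓ)) (≤-reflexive (begin
      degA m zero + prefixSum N (degA (tail m)) ℓ + suc s
        ≡⟨ +-suc _ s ⟩
      suc (degA m zero) + prefixSum N (degA (tail m)) ℓ + s
        ≡⟨ cong₂ (λ x y → x + y + s) top unchanged-prefix ⟨
      Σᶠ q R′ + prefixSum N (degA M′) ℓ + s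
        ∎))
      where open ≡-Reasoning
    ... | inj₂ saturated = ≤-trans
      (prefixSum≤saturated (suc N) a (degA (R′ ◂ M′)) (suc ℓ)
        (trans total (sym (Σᶠ-degA-cong (R′ ◂ M′) m columns)))
        (cong (Σᶠ q R′ +_) saturated))
      (m≤m+n _ s)

raise-top : ∀ {N q} s (m : BipMultigraph (suc N) q) (a : Fin (suc N) → ℕ) →
            a ≼⟨ s ⟩ degA m → Σᶠ (suc N) a ≡ Σᶠ (suc N) (degA m) →
            Rearrangement s m (λ m′ → a ≼ degA m′)
raise-top zero m a dom _ = unchanged (λ ℓ → subst (_ ≤_) (+-identityʳ _) (dom ℓ))
raise-top {N} (suc s) m a dom total with 0 <? Σᶠ N (degA (tail m))
... | yes 0<Σtail =
  raise-once s m a dom total 0<Σtail ⨾ λ same-total dom′ →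
  raise-top s _ a dom′ (trans total (sym same-total))
... | no 0≮Σtail = unchanged dom′
  where
    dom′ : a ≼ degA m
    dom′ zero    = z≤n
    dom′ (suc ℓ) = prefixSum≤saturated (suc N) a (degA m) (suc ℓ) total
      (cong (degA m zero +_) (Σᶠ≡0⇒prefixSum≡Σᶠ N _ ℓ (n≤0⇒n≡0 (≮⇒≥ 0≮Σtail))))

-- The starting multigraph

ones : ∀ n → ℕ → Fin n → ℕ
ones zero    k       ()
ones (suc n) zero    = 0 ◂ ones n zero
ones (suc n) (suc k) = 1 ◂ ones n k

Σᶠ-ones : ∀ n k → Σᶠ n (ones n k) ≡ n ⊓ k
Σᶠ-ones zero    k       = refl
Σᶠ-ones (suc n) zero    = trans (Σᶠ-ones n zero) (⊓-zeroʳ n)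
Σᶠ-ones (suc n) (suc k) = cong suc (Σᶠ-ones n k)

prefixSum-ones : ∀ n k {ℓ} → ℓ ≤ n → prefixSum n (ones n k) ℓ ≡ ℓ ⊓ k
prefixSum-ones n       k       {zero}  _         = refl
prefixSum-ones (suc n) zero    {suc ℓ} (s≤s ℓ≤n) = trans (prefixSum-ones n zero ℓ≤n) (⊓-zeroʳ ℓ)
prefixSum-ones (suc n) (suc k) {suc ℓ} (s≤s ℓ≤n) = cong suc (prefixSum-ones n k ℓ≤n)

excess-ones : ∀ n k → excess (ones n k) ≡ 0
excess-ones zero    k       = refl
excess-ones (suc n) zero    = excess-ones n zero
excess-ones (suc n) (suc k) = excess-ones n k

-- A column of degree v on the n + 1 rows of A: one edge to each of the first min(v, n + 1)
-- rows, and the surplus v ∸ (n + 1) as parallel edges to row 0.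
column : ∀ n → ℕ → Fin (suc n) → ℕ
column n zero    = ones (suc n) zero
column n (suc v) = suc (v ∸ n) ◂ ones n v

Σᶠ-column : ∀ n v → Σᶠ (suc n) (column n v) ≡ v
Σᶠ-column n zero    = Σᶠ-ones (suc n) zero
Σᶠ-column n (suc v) =
  cong suc (trans (cong ((v ∸ n) +_) (Σᶠ-ones n v)) (trans (+-comm (v ∸ n) (n ⊓ v)) (m⊓n+n∸m≡n n v)))

prefixSum-column : ∀ n v {ℓ} → ℓ ≤ n → prefixSum (suc n) (column n v) (suc ℓ) ≡ suc ℓ ⊓ v + (v ∸ suc n)
prefixSum-column n zero    ℓ≤n = prefixSum-ones (suc n) zero (s≤s ℓ≤n)
prefixSum-column n (suc v) {ℓ} ℓ≤n =
  cong suc (trans (cong ((v ∸ n) +_) (prefixSum-ones n v ℓ≤n)) (+-comm (v ∸ n) (ℓ ⊓ v)))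

excess-column : ∀ n v → excess (column n v) ≡ v ∸ suc n
excess-column n zero    = excess-ones (suc n) zero
excess-column n (suc v) = trans (cong ((v ∸ n) +_) (excess-ones n v)) (+-identityʳ _)

spread : ∀ {q} n → (Fin q → ℕ) → BipMultigraph (suc n) q
spread n b i j = column n (b j) i

degB-spread : ∀ {q} n (b : Fin q → ℕ) → degB (spread n b) ≗ b
degB-spread n b j = Σᶠ-column n (b j)

TotMult-spread : ∀ {q} n (b : Fin q → ℕ) → TotMult (spread n b) ≡ Σᶠ q (λ j → b j ∸ suc n)
TotMult-spread {q} n b =
  trans (Σᶠ-swap (suc n) q (λ i j → column n (b j) i ∸ 1)) (Σᶠ-cong q (excess-column n ∘ b))

prefixSum-degA-spread : ∀ {q} n (b : Fin q → ℕ) {ℓ} → ℓ ≤ n →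
                        prefixSum (suc n) (degA (spread n b)) (suc ℓ)
                          ≡ Σᶠ q (λ j → suc ℓ ⊓ b j) + Σᶠ q (λ j → b j ∸ suc n)
prefixSum-degA-spread {q} n b {ℓ} ℓ≤n =
  trans (prefixSum-swap (suc n) q (spread n b) (suc ℓ))
        (trans (Σᶠ-cong q (λ j → prefixSum-column n (b j) ℓ≤n)) (Σᶠ-+ q _ _))

sufficient : ∀ {p q} (a : Fin p → ℕ) (b : Fin q → ℕ) t → a Preserves Fin._≤_ ⟶ _≥_ →
             Σᶠ p a ≡ Σᶠ q b → (∀ ℓ → 1 ≤ ℓ → ℓ ≤ p → prefixSum p a ℓ ≤ Σᶠ q (λ j → ℓ ⊓ b j) + t) →
             Σ[ m ∈ BipMultigraph p q ] degA m ≗ a × degB m ≗ b × TotMult m ≤ t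
sufficient {zero} a b t _ total _ = (λ ()) , (λ ()) , (λ j → sym (Σᶠ≡0⇒≡0 _ b (sym total) j)) , z≤n
sufficient {suc n} {q} a b t a↘ total inequality =
  matrix r , satisfies r , (λ j → trans (columns r j) (degB-spread n b j)) , cost≤t
  where
    open Rearrangement
    m₀ = spread n b
    Σmin : ℕ → ℕ
    Σmin ℓ = Σᶠ q (λ j → ℓ ⊓ b j)
    surplus = Σᶠ q (λ j → b j ∸ suc n)

    surplus≤t : surplus ≤ t
    surplus≤t = +-cancelˡ-≤ (Σmin (suc n)) _ _ (begin
      Σmin (suc n) + surplus                    ≡⟨ Σᶠ-+ q _ _ ⟨
      Σᶠ q (λ j → suc n ⊓ b j + (b j ∸ suc n))  ≡⟨ Σᶠ-cong q (λ j → m⊓n+n∸m≡n (suc n) (b j)) ⟩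
      Σᶠ q b                                    ≡⟨ total ⟨
      Σᶠ (suc n) a                              ≡⟨ prefixSum-all (suc n) a (suc n) ≤-refl ⟨
      prefixSum (suc n) a (suc n)               ≤⟨ inequality (suc n) (s≤s z≤n) ≤-refl ⟩
      Σmin (suc n) + t                          ∎)
      where open ≤-Reasoning

    total₀ : Σᶠ (suc n) a ≡ Σᶠ (suc n) (degA m₀)
    total₀ = trans total (sym (trans (Σᶠ-degA≡Σᶠ-degB m₀) (Σᶠ-cong q (degB-spread n b))))

    slack : a ≼⟨ t ∸ surplus ⟩ degA m₀
    slack zero = z≤n
    slack (suc ℓ) with suc ℓ ≤? suc n
    ... | yes (s≤s ℓ≤n) = begin
      prefixSum (suc n) a (suc ℓ)
        ≤⟨ inequality (suc ℓ) (s≤s z≤n) (s≤s ℓ≤n) ⟩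
      Σmin (suc ℓ) + t
        ≡⟨ cong (Σmin (suc ℓ) +_) (m+[n∸m]≡n surplus≤t) ⟨
      Σmin (suc ℓ) + (surplus + (t ∸ surplus))
        ≡⟨ +-assoc (Σmin (suc ℓ)) surplus (t ∸ surplus) ⟨
      Σmin (suc ℓ) + surplus + (t ∸ surplus)
        ≡⟨ cong (_+ (t ∸ surplus)) (prefixSum-degA-spread n b ℓ≤n) ⟨
      prefixSum (suc n) (degA m₀) (suc ℓ) + (t ∸ surplus)
        ∎
      where open ≤-Reasoning
    ... | no ℓ≰n = ≤-trans
      (prefixSum≤saturated (suc n) a (degA m₀) (suc ℓ) total₀
        (prefixSum-all (suc n) (degA m₀) (suc ℓ) (<⇒≤ (≰⇒> ℓ≰n))))
      (m≤m+n _ _)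

    r : Rearrangement (t ∸ surplus + 0) m₀ (λ m → degA m ≗ a)
    r = raise-top (t ∸ surplus) m₀ a slack total₀ ⨾ λ same-total dom →
        rebalance _ a a↘ dom (trans total₀ (sym same-total))

    cost≤t : TotMult (matrix r) ≤ t
    cost≤t = begin
      TotMult (matrix r)                 ≤⟨ cost r ⟩
      TotMult m₀ + (t ∸ surplus + 0)     ≡⟨ cong₂ _+_ (TotMult-spread n b) (+-identityʳ _) ⟩
      surplus + (t ∸ surplus)            ≡⟨ m+[n∸m]≡n surplus≤t ⟩
      t                                  ∎
      where open ≤-Reasoning

sum≡Σᶠ-lookup : ∀ xs → sum xs ≡ Σᶠ (length xs) (lookup xs)
sum≡Σᶠ-lookup []       = refl
sum≡Σᶠ-lookup (x ∷ xs) = cong (x +_) (sum≡Σᶠ-lookup xs)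

sum-take≡prefixSum : ∀ ℓ xs → sum (take ℓ xs) ≡ prefixSum (length xs) (lookup xs) ℓ
sum-take≡prefixSum zero    xs       = refl
sum-take≡prefixSum (suc ℓ) []       = refl
sum-take≡prefixSum (suc ℓ) (x ∷ xs) = cong (x +_) (sum-take≡prefixSum ℓ xs)

sum-map≡Σᶠ : ∀ (f : ℕ → ℕ) xs → sum (map f xs) ≡ Σᶠ (length xs) (f ∘ lookup xs)
sum-map≡Σᶠ f []       = refl
sum-map≡Σᶠ f (x ∷ xs) = cong (f x +_) (sum-map≡Σᶠ f xs)

GaleRyserT≡prefixSum : ∀ t a b ℓ →
  GaleRyserT t a b ℓ ≡ (prefixSum (length a) (lookup a) ℓ ≤ Σᶠ (length b) (λ j → ℓ ⊓ lookup b j) + t)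
GaleRyserT≡prefixSum t a b ℓ =
  cong₂ _≤_ (sum-take≡prefixSum ℓ a) (cong (_+ t) (sum-map≡Σᶠ (ℓ ⊓_) b))

theorem11 : (d a b : List ℕ) (t : ℕ) →
    IsDegreeSequence d → IsBalancedPartition d a b →
    NonIncreasing a → NonIncreasing b → 1 ≤ t →
    TotBigraphic t a b ⇔ ((ℓ : ℕ) → 1 ≤ ℓ → ℓ ≤ length a → GaleRyserT t a b ℓ)
theorem11 d a b t _ (_ , balanced) a↘ _ _ = mk⇔
  (λ (m , degA≗a , degB≗b , cost) ℓ _ _ →
    subst id (sym (GaleRyserT≡prefixSum t a b ℓ))
      (necessary m (lookup a) (lookup b) t degA≗a degB≗b cost ℓ))
  (λ inequalities →
    sufficient (lookup a) (lookup b) t (lookup-mono-≤ ≥-totalOrder a↘)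
      (trans (sym (sum≡Σᶠ-lookup a)) (trans balanced (sum≡Σᶠ-lookup b)))
      (λ ℓ 1≤ℓ ℓ≤p → subst id (GaleRyserT≡prefixSum t a b ℓ) (inequalities ℓ 1≤ℓ ℓ≤p)))
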